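{- In any execution of Algorithm 1 (described in the context), let $\ell$ be the node with $\mathrm{ID}(\ell)=\mathrm{ID}_{\max}$. If $\rho_{cw}(\ell)\ge\mathrm{ID}(\ell)$ at some point, then $\rho_{cw}(v)\ge\mathrm{ID}(v)$ holds for every node $v$ at this point. That is, $\ell$ is the last node to satisfy $\rho_{cw}(\ell)\ge\mathrm{ID}(\ell)$.
   Context: Oriented ring of $n$ nodes, content-oblivious asynchronous model (content-free pulses, arbitrary finite delays, no loss or injection; each node has an incoming queue per port). Each node $v$ has a unique positive integer ID $\mathrm{ID}(v)$; $\mathrm{ID}_{\max}=\max_v\mathrm{ID}(v)$. $\rho_{cw}(v)$ and $\sigma_{cw}(v)$ are the numbers of clockwise (CW) pulses node $v$ has received (consumed from its queue) and sent, initially 0. Algorithm 1 at node $v$: first send one CW pulse; then loop forever: if a CW pulse is waiting, consume it (incrementing $\rho_{cw}(v)$); then if $\rho_{cw}(v)=\mathrm{ID}(v)$ set state to Leader and send nothing, otherwise set state to Non-Leader and send one CW pulse. -}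

module Defs where

open import Data.Nat using (ℕ; zero; suc; _≡ᵇ_)
open import Data.Nat.DivMod using (_mod_)
open import Data.Fin using (Fin; toℕ; _≟_)
open import Data.Bool using (Bool; true; false; if_then_else_)
open import Relation.Nullary using (does)
open import Relation.Binary.PropositionalEquality using (_≡_)
open import Relation.Binary.Construct.Closure.ReflexiveTransitive using (Star)

-- Oriented ring of n nodes 0,1,…,n-1; node i's clockwise neighbour is i+1 mod n.
-- A clockwise pulse sent by i is placed in the CW incoming queue of cw i.
cw : ∀ {n} → Fin n → Fin n
cw {suc m} i = suc (toℕ i) mod suc m

data NodeState : Set where
  Undecided Leader NonLeader : NodeState

-- Global configuration (only CW pulses are ever sent by Algorithm 1).
record Config (n : ℕ) : Set where
  field
    started : Fin n → Bool        -- has the node performed its initial CW send?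
    ρcw     : Fin n → ℕ           -- CW pulses received (consumed)
    σcw     : Fin n → ℕ           -- CW pulses sent
    queue   : Fin n → ℕ           -- pulses waiting in the node's CW incoming queue
    state   : Fin n → NodeState
open Config public

upd : ∀ {n} {A : Set} → (Fin n → A) → Fin n → A → (Fin n → A)
upd f i x j = if does (j ≟ i) then x else f j

initConfig : ∀ n → Config n
initConfig n = record
  { started = λ _ → false ; ρcw = λ _ → 0 ; σcw = λ _ → 0
  ; queue = λ _ → 0 ; state = λ _ → Undecided }

sendCW : ∀ {n} → Fin n → Config n → Config n
sendCW v c = record c
  { σcw = upd (σcw c) v (suc (σcw c v))
  ; queue = upd (queue c) (cw v) (suc (queue c (cw v))) }

consume : ∀ {n} → Fin n → ℕ → Config n → Config n
consume v k c = record c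
  { ρcw = upd (ρcw c) v (suc (ρcw c v))
  ; queue = upd (queue c) v k }

decide : ∀ {n} → (Fin n → ℕ) → Fin n → Config n → Config n
decide ID v c =
  if ρcw c v ≡ᵇ ID v
  then record c { state = upd (state c) v Leader }
  else sendCW v (record c { state = upd (state c) v NonLeader })

-- Atomic steps of Algorithm 1 (asynchronous scheduler chooses any enabled step).
data Step {n} (ID : Fin n → ℕ) : Config n → Config n → Set where
  initSend : ∀ c v → started c v ≡ false →
    Step ID c (sendCW v (record c { started = upd (started c) v true }))
  loopRecv : ∀ c v k → started c v ≡ true → queue c v ≡ suc k →
    Step ID c (decide ID v (consume v k c))

Reachable : ∀ {n} → (Fin n → ℕ) → Config n → Set
Reachable {n} ID c = Star (Step ID) (initConfig n) c

-- Pulses are conserved: what node w has sent is what cw w has received plus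
-- what waits in its queue.  A node sends one pulse more than it has received
-- until its counter reaches its ID, and afterwards exactly as many.  Hence if
-- cw w has received ID ℓ pulses, w has received ID ℓ pulses too, unless w has
-- not yet reached its own ID; but then it has sent at most ID w ≤ ID ℓ pulses,
-- forcing ID w = ID ℓ, i.e. w = ℓ.  Walking backwards around the ring from ℓ,
-- every node has received at least ID ℓ ≥ ID v pulses.
module Submission where

open import Defs
open import Data.Nat using (ℕ; _≤_; _≥_; _>_)
open import Data.Fin using (Fin)
open import Function.Definitions using (Injective)
open import Relation.Binary.PropositionalEquality using (_≡_)

open import Data.Bool using (Bool; true; false; if_then_else_; T)
open import Data.Fin using (toℕ; _≟_)
open import Data.Fin.Properties using (toℕ-fromℕ<; toℕ-injective; toℕ<n)
open import Data.Nat using (zero; suc; _+_; _∸_; _<_; _%_; _≡ᵇ_; z≤n; s≤s; s≤s⁻¹)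
open import Data.Nat.DivMod using (%-distribˡ-+; m%n%n≡m%n; [m+n]%n≡m%n; m<n⇒m%n≡m)
open import Data.Nat.GeneralisedArithmetic using (iterate)
open import Data.Nat.Properties
  using (+-suc; +-comm; +-assoc; +-identityʳ; m+[n∸m]≡n; m≤m+n; m≤n⇒m≤1+n;
         ≤-trans; ≤-reflexive; ≤-antisym; <⇒≤; <⇒≱; ≰⇒>; ≤∧≢⇒<; _≤?_; ≡⇒≡ᵇ)
open import Data.Product using (_×_; _,_)
open import Data.Sum using (_⊎_; inj₁; inj₂; [_,_]′)
open import Function using (_∘_; id)
open import Relation.Binary.Construct.Closure.ReflexiveTransitive using (fold)
open import Relation.Binary.PropositionalEquality using (_≢_; refl; sym; trans; cong; subst; module ≡-Reasoning)
open import Relation.Nullary using (yes; no; contradiction)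
open import Relation.Nullary.Decidable using (dec-true; dec-false)

open ≡-Reasoning

upd-≡ : ∀ {n} {A : Set} (f : Fin n → A) i x → upd f i x i ≡ x
upd-≡ f i x = cong (λ b → if b then x else f i) (dec-true (i ≟ i) refl)

upd-≢ : ∀ {n} {A : Set} (f : Fin n → A) i x {j} → j ≢ i → upd f i x j ≡ f j
upd-≢ f i x {j} j≢i = cong (λ b → if b then x else f j) (dec-false (j ≟ i) j≢i)

[m%n+k]%n≡[m+k]%n : ∀ m k n → (m % suc n + k) % suc n ≡ (m + k) % suc n
[m%n+k]%n≡[m+k]%n m k n = begin
  (m % suc n + k) % suc n                   ≡⟨ %-distribˡ-+ (m % suc n) k (suc n) ⟩
  (m % suc n % suc n + k % suc n) % suc n   ≡⟨ cong (λ x → (x + k % suc n) % suc n) (m%n%n≡m%n m (suc n)) ⟩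
  (m % suc n + k % suc n) % suc n           ≡⟨ %-distribˡ-+ m k (suc n) ⟨
  (m + k) % suc n                           ∎

[[1+i]%n+n∸1]%n≡i : ∀ {i m} → i < suc m → (suc i % suc m + m) % suc m ≡ i
[[1+i]%n+n∸1]%n≡i {i} {m} i<n = begin
  (suc i % suc m + m) % suc m   ≡⟨ [m%n+k]%n≡[m+k]%n (suc i) m m ⟩
  (suc i + m) % suc m           ≡⟨ cong (_% suc m) (+-suc i m) ⟨
  (i + suc m) % suc m           ≡⟨ [m+n]%n≡m%n i (suc m) ⟩
  i % suc m                     ≡⟨ m<n⇒m%n≡m i<n ⟩
  i                             ∎

toℕ-cw : ∀ {m} (i : Fin (suc m)) → toℕ (cw i) ≡ suc (toℕ i) % suc m
toℕ-cw i = toℕ-fromℕ< _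

cw-injective : ∀ {n} (i j : Fin n) → cw i ≡ cw j → i ≡ j
cw-injective {suc m} i j cwi≡cwj = toℕ-injective (begin
  toℕ i                               ≡⟨ [[1+i]%n+n∸1]%n≡i (toℕ<n i) ⟨
  (suc (toℕ i) % suc m + m) % suc m   ≡⟨ cong (λ x → (x + m) % suc m) 1+i≡1+j ⟩
  (suc (toℕ j) % suc m + m) % suc m   ≡⟨ [[1+i]%n+n∸1]%n≡i (toℕ<n j) ⟩
  toℕ j                               ∎)
  where
  1+i≡1+j : suc (toℕ i) % suc m ≡ suc (toℕ j) % suc m
  1+i≡1+j = trans (sym (toℕ-cw i)) (trans (cong toℕ cwi≡cwj) (toℕ-cw j))

toℕ-iterate-cw : ∀ {m} k (w : Fin (suc m)) → toℕ (iterate cw w k) ≡ (toℕ w + k) % suc m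
toℕ-iterate-cw {m} zero w = sym (begin
  (toℕ w + 0) % suc m   ≡⟨ cong (_% suc m) (+-identityʳ (toℕ w)) ⟩
  toℕ w % suc m         ≡⟨ m<n⇒m%n≡m (toℕ<n w) ⟩
  toℕ w                 ∎)
toℕ-iterate-cw {m} (suc k) w = begin
  toℕ (iterate cw (cw w) k)         ≡⟨ toℕ-iterate-cw k (cw w) ⟩
  (toℕ (cw w) + k) % suc m          ≡⟨ cong (λ x → (x + k) % suc m) (toℕ-cw w) ⟩
  (suc (toℕ w) % suc m + k) % suc m ≡⟨ [m%n+k]%n≡[m+k]%n (suc (toℕ w)) k m ⟩
  (suc (toℕ w) + k) % suc m         ≡⟨ cong (_% suc m) (+-suc (toℕ w) k) ⟨
  (toℕ w + suc k) % suc m           ∎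

iterate-cw-reaches : ∀ {m} (w ℓ : Fin (suc m)) → iterate cw w (suc m ∸ toℕ w + toℕ ℓ) ≡ ℓ
iterate-cw-reaches {m} w ℓ = toℕ-injective (begin
  toℕ (iterate cw w (n ∸ toℕ w + toℕ ℓ))   ≡⟨ toℕ-iterate-cw (n ∸ toℕ w + toℕ ℓ) w ⟩
  (toℕ w + (n ∸ toℕ w + toℕ ℓ)) % n       ≡⟨ cong (_% n) (+-assoc (toℕ w) (n ∸ toℕ w) (toℕ ℓ)) ⟨
  (toℕ w + (n ∸ toℕ w) + toℕ ℓ) % n       ≡⟨ cong (λ x → (x + toℕ ℓ) % n) (m+[n∸m]≡n (<⇒≤ (toℕ<n w))) ⟩
  (n + toℕ ℓ) % n                         ≡⟨ cong (_% n) (+-comm n (toℕ ℓ)) ⟩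
  (toℕ ℓ + n) % n                         ≡⟨ [m+n]%n≡m%n (toℕ ℓ) n ⟩
  toℕ ℓ % n                               ≡⟨ m<n⇒m%n≡m (toℕ<n ℓ) ⟩
  toℕ ℓ                                   ∎)
  where n = suc m

cw-backward-induction : ∀ {n} (P : Fin n → Set) → (∀ w → P (cw w) → P w) →
                        ∀ ℓ → P ℓ → ∀ w → P w
cw-backward-induction {suc m} P step ℓ Pℓ w =
  along (suc m ∸ toℕ w + toℕ ℓ) w (subst P (sym (iterate-cw-reaches w ℓ)) Pℓ)
  where
  along : ∀ k w → P (iterate cw w k) → P w
  along zero    w = id
  along (suc k) w = step w ∘ along k (cw w)

decide-cases : ∀ {n} (ID : Fin n → ℕ) c v →
  decide ID v c ≡ record c { state = upd (state c) v Leader }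
  ⊎ (ρcw c v ≢ ID v × decide ID v c ≡ sendCW v (record c { state = upd (state c) v NonLeader }))
decide-cases ID c v with ρcw c v ≡ᵇ ID v in eq
... | true  = inj₁ refl
... | false = inj₂ ((λ ρ≡ID → subst T eq (≡⇒≡ᵇ _ _ ρ≡ID)) , refl)

PulsesConserved : ∀ {n} → Config n → Set
PulsesConserved c = ∀ w → ρcw c (cw w) + queue c (cw w) ≡ σcw c w

sendCW-conserved : ∀ {n} (c : Config n) v → PulsesConserved c → PulsesConserved (sendCW v c)
sendCW-conserved c v conserved w with w ≟ v
... | yes refl = begin
  ρcw c (cw v) + upd (queue c) (cw v) (suc (queue c (cw v))) (cw v)
    ≡⟨ cong (ρcw c (cw v) +_) (upd-≡ (queue c) (cw v) _) ⟩
  ρcw c (cw v) + suc (queue c (cw v))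
    ≡⟨ +-suc (ρcw c (cw v)) _ ⟩
  suc (ρcw c (cw v) + queue c (cw v))
    ≡⟨ cong suc (conserved v) ⟩
  suc (σcw c v) ∎
... | no w≢v = trans (cong (ρcw c (cw w) +_) (upd-≢ (queue c) (cw v) _ (w≢v ∘ cw-injective w v)))
                     (conserved w)

consume-conserved : ∀ {n} (c : Config n) {v k} → queue c v ≡ suc k →
                    PulsesConserved c → PulsesConserved (consume v k c)
consume-conserved c {v} {k} waiting conserved w with cw w ≟ v
... | yes refl = begin
  suc (ρcw c (cw w) + k)              ≡⟨ +-suc (ρcw c (cw w)) k ⟨
  ρcw c (cw w) + suc k                ≡⟨ cong (ρcw c (cw w) +_) waiting ⟨
  ρcw c (cw w) + queue c (cw w)       ≡⟨ conserved w ⟩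
  σcw c w                             ∎
... | no _ = conserved w

-- Arguments: the node's ID, whether it has started, its counters ρcw and σcw.
-- A started node has sent at most one pulse per pulse received plus its initial
-- one; once its counter has reached its ID, where it keeps a pulse, not even that.
NodeInvariant : ℕ → Bool → ℕ → ℕ → Set
NodeInvariant _  false ρ σ = σ ≡ 0 × ρ ≡ 0
NodeInvariant i  true  ρ σ = σ ≤ suc ρ × (i ≤ ρ → σ ≤ ρ)

module _ {i ρ σ : ℕ} where

  nodeInvariant-start : ∀ {b} → 0 < i → b ≡ false → NodeInvariant i b ρ σ → NodeInvariant i true ρ (suc σ)
  nodeInvariant-start 0<i refl (refl , refl) = s≤s z≤n , λ i≤0 → contradiction i≤0 (<⇒≱ 0<i)

  nodeInvariant-absorb : ∀ {b} → b ≡ true → NodeInvariant i b ρ σ → NodeInvariant i b (suc ρ) σ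
  nodeInvariant-absorb refl (σ≤1+ρ , _) = m≤n⇒m≤1+n σ≤1+ρ , λ _ → σ≤1+ρ

  nodeInvariant-forward : ∀ {b} → suc ρ ≢ i → b ≡ true → NodeInvariant i b ρ σ →
                          NodeInvariant i b (suc ρ) (suc σ)
  nodeInvariant-forward 1+ρ≢i refl (σ≤1+ρ , decided) =
    s≤s σ≤1+ρ , λ i≤1+ρ → s≤s (decided (s≤s⁻¹ (≤∧≢⇒< i≤1+ρ (1+ρ≢i ∘ sym))))

  sent≤received : ∀ {b} → NodeInvariant i b ρ σ → i ≤ ρ → σ ≤ ρ
  sent≤received {false} (refl , _) _ = z≤n
  sent≤received {true}  (_ , decided) = decided

  sent≤id : ∀ {b} → NodeInvariant i b ρ σ → ρ < i → σ ≤ i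
  sent≤id {false} (refl , _) _ = z≤n
  sent≤id {true}  (σ≤1+ρ , _) ρ<i = ≤-trans σ≤1+ρ ρ<i

record Invariant {n} (ID : Fin n → ℕ) (c : Config n) : Set where
  field
    conserved : PulsesConserved c
    local     : ∀ w → NodeInvariant (ID w) (started c w) (ρcw c w) (σcw c w)
open Invariant

module _ {n} (ID : Fin n → ℕ) (ID>0 : ∀ v → ID v > 0) where

  invariant-init : Invariant ID (initConfig n)
  invariant-init = record { conserved = λ _ → refl ; local = λ _ → refl , refl }

  invariant-initSend : ∀ {c v} → started c v ≡ false → Invariant ID c →
                       Invariant ID (sendCW v (record c { started = upd (started c) v true }))
  invariant-initSend {c} {v} idle I = record { conserved = sendCW-conserved c′ v (conserved I) ; local = started′ }
    where
    c′ : Config n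
    c′ = record c { started = upd (started c) v true }

    started′ : ∀ w → NodeInvariant (ID w) (upd (started c) v true w) (ρcw c w) (upd (σcw c) v (suc (σcw c v)) w)
    started′ w with w ≟ v
    ... | yes refl = nodeInvariant-start (ID>0 v) idle (local I v)
    ... | no _     = local I w

  invariant-loopRecv : ∀ {c v k} → started c v ≡ true → queue c v ≡ suc k → Invariant ID c →
                       Invariant ID (decide ID v (consume v k c))
  invariant-loopRecv {c} {v} {k} running waiting I =
    [ (λ leader → subst (Invariant ID) (sym leader)
                          (record { conserved = conserved′ ; local = absorbed }))
    , (λ (ρ′≢ID , nonLeader) → subst (Invariant ID) (sym nonLeader)
                          (record { conserved = sendCW-conserved c′ v conserved′
                                  ; local = forwarded (ρ′≢ID ∘ trans (upd-≡ (ρcw c) v _)) }))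
    ]′ (decide-cases ID (consume v k c) v)
    where
    c′ : Config n
    c′ = record (consume v k c) { state = upd (state c) v NonLeader }

    conserved′ : PulsesConserved (consume v k c)
    conserved′ = consume-conserved c waiting (conserved I)

    absorbed : ∀ w → NodeInvariant (ID w) (started c w) (upd (ρcw c) v (suc (ρcw c v)) w) (σcw c w)
    absorbed w with w ≟ v
    ... | yes refl = nodeInvariant-absorb running (local I v)
    ... | no _     = local I w

    forwarded : suc (ρcw c v) ≢ ID v →
                ∀ w → NodeInvariant (ID w) (started c w) (upd (ρcw c) v (suc (ρcw c v)) w)
                                                          (upd (σcw c) v (suc (σcw c v)) w)
    forwarded 1+ρ≢ID w with w ≟ v
    ... | yes refl = nodeInvariant-forward 1+ρ≢ID running (local I v)
    ... | no _     = local I w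

  invariant-step : ∀ {c c′} → Step ID c c′ → Invariant ID c → Invariant ID c′
  invariant-step (initSend c v idle)              = invariant-initSend idle
  invariant-step (loopRecv c v k running waiting) = invariant-loopRecv running waiting

  reachable⇒invariant : ∀ {c} → Reachable ID c → Invariant ID c
  reachable⇒invariant r = fold (λ c c′ → Invariant ID c → Invariant ID c′)
                               (λ step rest → rest ∘ invariant-step step) id r invariant-init

received≤sent-by-predecessor : ∀ {n} {ID : Fin n → ℕ} {c} → Invariant ID c → ∀ w → ρcw c (cw w) ≤ σcw c w
received≤sent-by-predecessor I w = ≤-trans (m≤m+n _ _) (≤-reflexive (conserved I w))

sent-maxID⇒received-maxID :
  ∀ {n} {ID : Fin n → ℕ} → Injective _≡_ _≡_ ID → ∀ {ℓ} → (∀ v → ID v ≤ ID ℓ) →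
  ∀ {c} → Invariant ID c → ID ℓ ≤ ρcw c ℓ → ∀ w → ID ℓ ≤ σcw c w → ID ℓ ≤ ρcw c w
sent-maxID⇒received-maxID {ID = ID} ID-injective {ℓ} ID≤IDℓ {c} I IDℓ≤ρℓ w IDℓ≤σ
  with ID w ≤? ρcw c w
... | yes IDw≤ρ = ≤-trans IDℓ≤σ (sent≤received (local I w) IDw≤ρ)
... | no  IDw≰ρ with ID-injective (≤-antisym (ID≤IDℓ w) (≤-trans IDℓ≤σ (sent≤id (local I w) (≰⇒> IDw≰ρ))))
...   | refl = IDℓ≤ρℓ

lemma3p2 : (n : ℕ) (ID : Fin n → ℕ) → Injective _≡_ _≡_ ID → (∀ v → ID v > 0) →
           (ℓ : Fin n) → (∀ v → ID v ≤ ID ℓ) →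
           (c : Config n) → Reachable ID c →
           ρcw c ℓ ≥ ID ℓ → ∀ v → ρcw c v ≥ ID v
lemma3p2 n ID ID-injective ID>0 ℓ ID≤IDℓ c reachable IDℓ≤ρℓ v =
  ≤-trans (ID≤IDℓ v) (cw-backward-induction (λ w → ID ℓ ≤ ρcw c w) propagate ℓ IDℓ≤ρℓ v)
  where
  I : Invariant ID c
  I = reachable⇒invariant ID ID>0 reachable

  propagate : ∀ w → ID ℓ ≤ ρcw c (cw w) → ID ℓ ≤ ρcw c w
  propagate w IDℓ≤ρ′ =
    sent-maxID⇒received-maxID ID-injective ID≤IDℓ I IDℓ≤ρℓ w (≤-trans IDℓ≤ρ′ (received≤sent-by-predecessor I w))
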